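{- Let $q$ be a prime with $q\equiv 3\pmod 4$ and $S=\{2,q\}$. If $(a,b,c,d)$ is an $S$-Diophantine quadruple, then $a,b,c,d$ are all odd.
   Context: For a finite set $S$ of primes, a positive integer is an $S$-unit if all its prime factors lie in $S$. A quadruple $(a,b,c,d)$ of positive, pairwise distinct integers is an $S$-Diophantine quadruple if the product of any two distinct entries plus $1$ is an $S$-unit. -}

module Defs where

open import Data.Nat using (ℕ; _*_; _+_; _<_; _%_)
open import Data.Nat.Divisibility using (_∣_)
open import Data.Nat.Primality using (Prime)
open import Data.Product using (_×_)
open import Data.Sum using (_⊎_)
open import Relation.Binary.PropositionalEquality using (_≡_; _≢_)

IsSUnit₂ : ℕ → ℕ → Set
IsSUnit₂ q n = 0 < n × (∀ p → Prime p → p ∣ n → p ≡ 2 ⊎ p ≡ q)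

IsSDiophantineQuadruple₂ : ℕ → ℕ → ℕ → ℕ → ℕ → Set
IsSDiophantineQuadruple₂ q a b c d =
  (0 < a × 0 < b × 0 < c × 0 < d) ×
  (a ≢ b × a ≢ c × a ≢ d × b ≢ c × b ≢ d × c ≢ d) ×
  (IsSUnit₂ q (a * b + 1) × IsSUnit₂ q (a * c + 1) × IsSUnit₂ q (a * d + 1) ×
   IsSUnit₂ q (b * c + 1) × IsSUnit₂ q (b * d + 1) × IsSUnit₂ q (c * d + 1))

-- If a is even, then each of ab+1, ac+1, ad+1 is an odd S-unit, hence divisible by q.
-- As −1 is not a square modulo a prime q ≡ 3 (mod 4), q cannot also divide bc+1, since
-- (ab+1)(bc+1) + (ac+1) = (ab+1) + (bc+1) + ac(b²+1).  So bc+1, bd+1 and cd+1 are powers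
-- of 2 larger than 2, giving bc ≡ bd ≡ cd ≡ 3 (mod 4) and (bcd)² ≡ 3³ ≡ 3 (mod 4), which
-- no square is.  That −1 is a non-residue follows from Fermat's little theorem, obtained
-- from the freshman's dream (x+1)^p ≡ x^p + 1 (mod p).
module Submission where

open import Defs
open import Data.Nat using (ℕ; zero; suc; _+_; _*_; _∸_; _^_; _%_; _/_; _!; _≤_; _<_; z≤n; s≤s; NonZero; nonTrivial⇒≢1; +-*-rawSemiring)
open import Data.Nat.Properties
open import Data.Nat.DivMod using (%-distribˡ-+; %-distribˡ-*; %-remove-+ˡ; %-remove-+ʳ; %-pred-≡0; m%n<n; m≡m%n+[m/n]*n; m/n*n≡m)
open import Data.Nat.Divisibility
open import Data.Nat.Primality using (Prime; prime[2]; euclidsLemma; prime⇒nonTrivial)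
open import Data.Nat.Primality.Factorisation using (factorise)
open import Data.Nat.Combinatorics using (_C_; nCn≡1; nCk≡n!/k![n-k]!; k![n∸k]!∣n!)
open import Data.Nat.ListAction using (product)
open import Data.Nat.Solver using (module +-*-Solver)
open import Data.Fin.Base using (Fin; zero; suc; toℕ; inject₁; fromℕ)
open import Data.Fin.Properties using (toℕ-fromℕ; inject₁ℕ<)
open import Data.Vec.Functional using (Vector)
open import Data.List using ([]; _∷_)
open import Data.List.Relation.Unary.All using (_∷_)
open import Data.Product using (_×_; _,_; proj₂; ∃-syntax)
open import Data.Sum using (_⊎_; inj₁; inj₂)
open import Data.Empty using (⊥-elim)
open import Relation.Nullary using (¬_)
open import Relation.Binary.PropositionalEquality using (_≡_; _≢_; refl; sym; trans; cong; cong₂; subst; module ≡-Reasoning)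
import Algebra.Definitions.RawSemiring +-*-rawSemiring as RawSemiring
import Algebra.Properties.CommutativeSemiring.Binomial +-*-commutativeSemiring as Binomial
open import Algebra.Properties.Monoid.Sum +-0-monoid using (sum; sum-init-last)

open +-*-Solver

module Congruence (d : ℕ) .{{_ : NonZero d}} where

  infix 4 _≈_
  _≈_ : ℕ → ℕ → Set
  m ≈ n = m % d ≡ n % d

  +-cong : ∀ {m n u v} → m ≈ n → u ≈ v → m + u ≈ n + v
  +-cong {m} {n} {u} {v} m≈n u≈v = begin
    (m + u) % d            ≡⟨ %-distribˡ-+ m u d ⟩
    (m % d + u % d) % d    ≡⟨ cong₂ (λ x y → (x + y) % d) m≈n u≈v ⟩
    (n % d + v % d) % d    ≡⟨ %-distribˡ-+ n v d ⟨
    (n + v) % d            ∎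
    where open ≡-Reasoning

  *-cong : ∀ {m n u v} → m ≈ n → u ≈ v → m * u ≈ n * v
  *-cong {m} {n} {u} {v} m≈n u≈v = begin
    (m * u) % d            ≡⟨ %-distribˡ-* m u d ⟩
    (m % d * (u % d)) % d  ≡⟨ cong₂ (λ x y → (x * y) % d) m≈n u≈v ⟩
    (n % d * (v % d)) % d  ≡⟨ %-distribˡ-* n v d ⟨
    (n * v) % d            ∎
    where open ≡-Reasoning

  ^-cong : ∀ {m n} k → m ≈ n → m ^ k ≈ n ^ k
  ^-cong zero    m≈n = refl
  ^-cong (suc k) m≈n = *-cong m≈n (^-cong k m≈n)

MinusOneNonResidue : ℕ → Set
MinusOneNonResidue q = ∀ x → ¬ q ∣ x * x + 1

module _ {p : ℕ} (prime : Prime p) where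

  private instance
    p>1 = prime⇒nonTrivial prime

  prime∤1 : ¬ p ∣ 1
  prime∤1 p∣1 = nonTrivial⇒≢1 (∣1⇒≡1 p∣1)

  prime∤* : ∀ {a b} → ¬ p ∣ a → ¬ p ∣ b → ¬ p ∣ a * b
  prime∤* {a} {b} p∤a p∤b p∣ab with euclidsLemma a b prime p∣ab
  ... | inj₁ p∣a = p∤a p∣a
  ... | inj₂ p∣b = p∤b p∣b

RawSemiring-^≡^ : ∀ x n → x RawSemiring.^ n ≡ x ^ n
RawSemiring-^≡^ x zero    = refl
RawSemiring-^≡^ x (suc n) = cong (x *_) (RawSemiring-^≡^ x n)

RawSemiring-×≡* : ∀ n x → n RawSemiring.× x ≡ n * x
RawSemiring-×≡* zero    x = refl
RawSemiring-×≡* (suc n) x = cong (x +_) (RawSemiring-×≡* n x)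

∣sum : ∀ {d n} (f : Vector ℕ n) → (∀ i → d ∣ f i) → d ∣ sum f
∣sum {n = zero}  f d∣f = _ ∣0
∣sum {n = suc n} f d∣f = ∣m∣n⇒∣m+n (d∣f zero) (∣sum (λ i → f (suc i)) (λ i → d∣f (suc i)))

binomialTerm[x,1] : ∀ n x k → Binomial.binomialTerm x 1 n k ≡ (n C toℕ k) * x ^ toℕ k
binomialTerm[x,1] n x k = begin
  (n C i) RawSemiring.× (x RawSemiring.^ i * 1 RawSemiring.^ (n ∸ i))
    ≡⟨ RawSemiring-×≡* (n C i) _ ⟩
  (n C i) * (x RawSemiring.^ i * 1 RawSemiring.^ (n ∸ i))
    ≡⟨ cong₂ (λ u v → (n C i) * (u * v)) (RawSemiring-^≡^ x i) (trans (RawSemiring-^≡^ 1 (n ∸ i)) (^-zeroˡ (n ∸ i))) ⟩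
  (n C i) * (x ^ i * 1)
    ≡⟨ cong ((n C i) *_) (*-identityʳ (x ^ i)) ⟩
  (n C i) * x ^ i
    ∎
  where
  open ≡-Reasoning
  i = toℕ k

-- The prime is written suc n so that the binomial sum over Fin (suc p) splits off its
-- first and last terms.
module PrimeModulus {n : ℕ} (prime : Prime (suc n)) where

  p : ℕ
  p = suc n

  open Congruence p

  p∤m! : ∀ {m} → m < p → ¬ p ∣ m !
  p∤m! {zero}  _   = prime∤1 prime
  p∤m! {suc m} m<p = prime∤* prime (λ p∣m → <⇒≱ m<p (∣⇒≤ p∣m)) (p∤m! (<-trans (n<1+n m) m<p))

  p∣pCk : ∀ {k} → 0 < k → k < p → p ∣ p C k
  p∣pCk {k} 0<k k<p with euclidsLemma (p C k) (k ! * (p ∸ k) !) prime p∣pCk*k!*[p∸k]!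
    where
    instance _ = k !* (p ∸ k) !≢0
    p∣pCk*k!*[p∸k]! : p ∣ (p C k) * (k ! * (p ∸ k) !)
    p∣pCk*k!*[p∸k]! = subst (p ∣_)
      (sym (trans (cong (_* (k ! * (p ∸ k) !)) (nCk≡n!/k![n-k]! (<⇒≤ k<p))) (m/n*n≡m (k![n∸k]!∣n! (<⇒≤ k<p)))))
      (m∣m*n (n !))
  ... | inj₁ p∣pCk = p∣pCk
  ... | inj₂ p∣k!*[p∸k]! = ⊥-elim (prime∤* prime (p∤m! k<p) (p∤m! (∸-monoʳ-< 0<k (<⇒≤ k<p))) p∣k!*[p∸k]!)

  freshman's-dream : ∀ x → (x + 1) ^ p ≈ x ^ p + 1
  freshman's-dream x = begin
    (x + 1) ^ p % p                      ≡⟨ cong (_% p) expansion ⟩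
    (t zero + (sum middle + t top)) % p  ≡⟨ cong₂ (λ u v → (u + (sum middle + v)) % p) first last ⟩
    (1 + (sum middle + x ^ p)) % p       ≡⟨ cong (_% p) (solve 2 (λ s y → con 1 :+ (s :+ y) := s :+ (y :+ con 1)) refl (sum middle) (x ^ p)) ⟩
    (sum middle + (x ^ p + 1)) % p       ≡⟨ %-remove-+ˡ (x ^ p + 1) (∣sum middle p∣middle) ⟩
    (x ^ p + 1) % p                      ∎
    where
    open ≡-Reasoning
    t : Vector ℕ (suc p)
    t = Binomial.binomialTerm x 1 p
    top : Fin (suc p)
    top = suc (fromℕ n)
    middle : Vector ℕ n
    middle i = t (suc (inject₁ i))
    expansion : (x + 1) ^ p ≡ t zero + (sum middle + t top)
    expansion = trans (sym (RawSemiring-^≡^ (x + 1) p))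
      (trans (Binomial.theorem p x 1) (cong (t zero +_) (sum-init-last (λ i → t (suc i)))))
    first : t zero ≡ 1
    first = binomialTerm[x,1] p x zero
    last : t top ≡ x ^ p
    last = begin
      t top                                                 ≡⟨ binomialTerm[x,1] p x top ⟩
      (p C suc (toℕ (fromℕ n))) * x ^ suc (toℕ (fromℕ n))  ≡⟨ cong (λ i → (p C suc i) * x ^ suc i) (toℕ-fromℕ n) ⟩
      (p C p) * x ^ p                                       ≡⟨ cong (_* x ^ p) (nCn≡1 p) ⟩
      1 * x ^ p                                             ≡⟨ *-identityˡ (x ^ p) ⟩
      x ^ p                                                 ∎
    p∣middle : ∀ i → p ∣ middle i
    p∣middle i = subst (p ∣_) (sym (binomialTerm[x,1] p x (suc (inject₁ i))))
      (∣m⇒∣m*n _ (p∣pCk (s≤s z≤n) (s≤s (inject₁ℕ< i))))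

  fermat : ∀ x → x ^ p ≈ x
  fermat zero    = refl
  fermat (suc x) = begin
    suc x ^ p % p    ≡⟨ cong (λ y → y ^ p % p) (+-comm 1 x) ⟩
    (x + 1) ^ p % p  ≡⟨ freshman's-dream x ⟩
    (x ^ p + 1) % p  ≡⟨ +-cong {x ^ p} {x} {1} {1} (fermat x) refl ⟩
    (x + 1) % p      ≡⟨ cong (_% p) (+-comm x 1) ⟩
    suc x % p        ∎
    where open ≡-Reasoning

  -1-nonresidue : p % 4 ≡ 3 → MinusOneNonResidue p
  -1-nonresidue p%4≡3 b p∣a+1 = <⇒≱ 2<p (∣⇒≤ p∣2)
    where
    open ≡-Reasoning
    k = p / 4
    a = b * b
    p≡3+k*4 : p ≡ 3 + k * 4
    p≡3+k*4 = trans (m≡m%n+[m/n]*n p 4) (cong (_+ k * 4) p%4≡3)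
    2<p : 2 < p
    2<p = subst (3 ≤_) (sym p≡3+k*4) (m≤m+n 3 (k * 4))
    a²≈1 : a * a ≈ 1
    a²≈1 = begin
      (a * a) % p            ≡⟨ %-remove-+ʳ (a * a) p∣a+1 ⟨
      (a * a + (a + 1)) % p  ≡⟨ cong (_% p) (solve 1 (λ a → a :* a :+ (a :+ con 1) := a :* (a :+ con 1) :+ con 1) refl a) ⟩
      (a * (a + 1) + 1) % p  ≡⟨ %-remove-+ˡ 1 (∣n⇒∣m*n a p∣a+1) ⟩
      1 % p                  ∎
    b^[p+1]≡[a²]^[k+1] : b ^ suc p ≡ (a * a) ^ suc k
    b^[p+1]≡[a²]^[k+1] = begin
      b ^ suc p        ≡⟨ cong (λ m → b ^ suc m) p≡3+k*4 ⟩
      b ^ (4 + k * 4)  ≡⟨ cong (b ^_) (*-comm (suc k) 4) ⟩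
      b ^ (4 * suc k)  ≡⟨ ^-*-assoc b 4 (suc k) ⟨
      (b ^ 4) ^ suc k  ≡⟨ cong (_^ suc k) (solve 1 (λ b → b :^ 4 := b :* b :* (b :* b)) refl b) ⟩
      (a * a) ^ suc k  ∎
    a≈1 : a ≈ 1
    a≈1 = begin
      (b * b) % p          ≡⟨ *-cong {b} {b} {b ^ p} {b} refl (fermat b) ⟨
      b ^ suc p % p        ≡⟨ cong (_% p) b^[p+1]≡[a²]^[k+1] ⟩
      (a * a) ^ suc k % p  ≡⟨ ^-cong {a * a} {1} (suc k) a²≈1 ⟩
      1 ^ suc k % p        ≡⟨ cong (_% p) (^-zeroˡ (suc k)) ⟩
      1 % p                ∎
    p∣2 : p ∣ 2
    p∣2 = m%n≡0⇒n∣m 2 p (trans (sym (+-cong {a} {1} {1} {1} a≈1 refl)) (n∣m⇒m%n≡0 (a + 1) p p∣a+1))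

q∣ab+1∧q∣ac+1⇒q∤bc+1 : ∀ {q a b c} → Prime q → MinusOneNonResidue q →
                         q ∣ a * b + 1 → q ∣ a * c + 1 → ¬ q ∣ b * c + 1
q∣ab+1∧q∣ac+1⇒q∤bc+1 {q} {a} {b} {c} q-prime nonres q∣ab+1 q∣ac+1 q∣bc+1 =
  prime∤* q-prime (prime∤* q-prime q∤a q∤c) (nonres b) q∣ac[b²+1]
  where
  identity : (a * b + 1) * (b * c + 1) + (a * c + 1) ≡ (a * b + 1) + (b * c + 1) + a * c * (b * b + 1)
  identity = solve 3 (λ a b c → (a :* b :+ con 1) :* (b :* c :+ con 1) :+ (a :* c :+ con 1)
                              := (a :* b :+ con 1) :+ (b :* c :+ con 1) :+ a :* c :* (b :* b :+ con 1)) refl a b c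
  q∣ac[b²+1] : q ∣ a * c * (b * b + 1)
  q∣ac[b²+1] = ∣m+n∣m⇒∣n (subst (q ∣_) identity (∣m∣n⇒∣m+n (∣m⇒∣m*n (b * c + 1) q∣ab+1) q∣ac+1))
                         (∣m∣n⇒∣m+n q∣ab+1 q∣bc+1)
  q∤a : ¬ q ∣ a
  q∤a q∣a = prime∤1 q-prime (∣m+n∣m⇒∣n q∣ab+1 (∣m⇒∣m*n b q∣a))
  q∤c : ¬ q ∣ c
  q∤c q∣c = prime∤1 q-prime (∣m+n∣m⇒∣n q∣ac+1 (∣n⇒∣m*n a q∣c))

primeDivisor : ∀ {m} → 2 ≤ m → ∃[ p ] Prime p × p ∣ m
primeDivisor {m@(suc _)} 2≤m with factorise m
... | record { factors = [] ; isFactorisation = m≡1 } = ⊥-elim (<⇒≢ 2≤m (sym m≡1))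
... | record { factors = p ∷ ps ; isFactorisation = m≡p*ps ; factorsPrime = p-prime ∷ _ } =
  p , p-prime , subst (p ∣_) (sym m≡p*ps) (m∣m*n (product ps))

allPrimeDivisors≡⇒∣ : ∀ {r m} → 2 ≤ m → (∀ p → Prime p → p ∣ m → p ≡ r) → r ∣ m
allPrimeDivisors≡⇒∣ 2≤m only-r with primeDivisor 2≤m
... | p , p-prime , p∣m = subst (_∣ _) (only-r p p-prime p∣m) p∣m

allPrimeDivisors≡2⇒4∣ : ∀ {m} → 3 ≤ m → (∀ p → Prime p → p ∣ m → p ≡ 2) → 4 ∣ m
allPrimeDivisors≡2⇒4∣ {m} 3≤m only-2 with allPrimeDivisors≡⇒∣ (<⇒≤ 3≤m) only-2
... | divides k m≡k*2 = subst (4 ∣_) (sym m≡k*2) (*-monoˡ-∣ 2 2∣k)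
  where
  k∣m : k ∣ m
  k∣m = divides 2 (trans m≡k*2 (*-comm k 2))
  2≤k : 2 ≤ k
  2≤k = *-cancelʳ-< 2 1 k (subst (2 <_) m≡k*2 3≤m)
  2∣k : 2 ∣ k
  2∣k = allPrimeDivisors≡⇒∣ 2≤k (λ p p-prime p∣k → only-2 p p-prime (∣-trans p∣k k∣m))

module _ {q m : ℕ} (m-unit : IsSUnit₂ q m) where

  private
    in-S : ∀ p → Prime p → p ∣ m → p ≡ 2 ⊎ p ≡ q
    in-S = proj₂ m-unit

  oddSUnit⇒q∣ : 2 ≤ m → ¬ 2 ∣ m → q ∣ m
  oddSUnit⇒q∣ 2≤m 2∤m = allPrimeDivisors≡⇒∣ 2≤m only-q
    where
    only-q : ∀ p → Prime p → p ∣ m → p ≡ q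
    only-q p p-prime p∣m with in-S p p-prime p∣m
    ... | inj₁ refl = ⊥-elim (2∤m p∣m)
    ... | inj₂ p≡q  = p≡q

  sUnit∧q∤⇒4∣ : 3 ≤ m → ¬ q ∣ m → 4 ∣ m
  sUnit∧q∤⇒4∣ 3≤m q∤m = allPrimeDivisors≡2⇒4∣ 3≤m only-2
    where
    only-2 : ∀ p → Prime p → p ∣ m → p ≡ 2
    only-2 p p-prime p∣m with in-S p p-prime p∣m
    ... | inj₁ p≡2  = p≡2
    ... | inj₂ refl = ⊥-elim (q∤m p∣m)

sUnit-comm : ∀ {q} x y → IsSUnit₂ q (x * y + 1) → IsSUnit₂ q (y * x + 1)
sUnit-comm {q} x y = subst (λ m → IsSUnit₂ q (m + 1)) (*-comm x y)

module _ where

  open Congruence 4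

  4∣[m+1]⇒m≈3 : ∀ m → 4 ∣ m + 1 → m ≈ 3
  4∣[m+1]⇒m≈3 m 4∣m+1 = %-pred-≡0 {m} {4} (n∣m⇒m%n≡0 (suc m) 4 (subst (4 ∣_) (+-comm m 1) 4∣m+1))

  square≉3 : ∀ n → ¬ n * n ≈ 3
  square≉3 n n²≈3 = residue-square≢3 (n % 4) (m%n<n n 4) (trans (sym (%-distribˡ-* n n 4)) n²≈3)
    where
    residue-square≢3 : ∀ r → r < 4 → ¬ r * r % 4 ≡ 3
    residue-square≢3 0 _ ()
    residue-square≢3 1 _ ()
    residue-square≢3 2 _ ()
    residue-square≢3 3 _ ()
    residue-square≢3 (suc (suc (suc (suc _)))) (s≤s (s≤s (s≤s (s≤s ())))) _

  ¬4∣pairwise : ∀ b c d → 4 ∣ b * c + 1 → 4 ∣ b * d + 1 → ¬ 4 ∣ c * d + 1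
  ¬4∣pairwise b c d 4∣bc+1 4∣bd+1 4∣cd+1 = square≉3 (b * c * d) (begin
    (b * c * d) * (b * c * d) % 4      ≡⟨ cong (_% 4) (solve 3 (λ b c d → (b :* c :* d) :* (b :* c :* d) := (b :* c) :* ((b :* d) :* (c :* d))) refl b c d) ⟩
    (b * c) * ((b * d) * (c * d)) % 4  ≡⟨ *-cong {b * c} {3} {b * d * (c * d)} {3 * 3} (4∣[m+1]⇒m≈3 (b * c) 4∣bc+1)
                                            (*-cong {b * d} {3} {c * d} {3} (4∣[m+1]⇒m≈3 (b * d) 4∣bd+1) (4∣[m+1]⇒m≈3 (c * d) 4∣cd+1)) ⟩
    3 * (3 * 3) % 4                    ≡⟨⟩
    3 % 4                              ∎)
    where open ≡-Reasoning

2≤m*n : ∀ {m n} → 0 < m → 0 < n → m ≢ n → 2 ≤ m * n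
2≤m*n {1}           {1}           _ _ m≢n = ⊥-elim (m≢n refl)
2≤m*n {1}           {suc (suc n)} _ _ _   = s≤s (s≤s z≤n)
2≤m*n {suc (suc m)} {suc n}       _ _ _   = s≤s (≤-trans (s≤s z≤n) (m≤n+m (suc m * suc n) n))

no-even-entry : ∀ {q a b c d} → Prime q → MinusOneNonResidue q →
                0 < a → 0 < b → 0 < c → 0 < d → b ≢ c → b ≢ d → c ≢ d →
                IsSUnit₂ q (a * b + 1) → IsSUnit₂ q (a * c + 1) → IsSUnit₂ q (a * d + 1) →
                IsSUnit₂ q (b * c + 1) → IsSUnit₂ q (b * d + 1) → IsSUnit₂ q (c * d + 1) →
                ¬ 2 ∣ a
no-even-entry {q} {a} {b} {c} {d} q-prime nonres 0<a 0<b 0<c 0<d b≢c b≢d c≢d ab ac ad bc bd cd 2∣a =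
  ¬4∣pairwise b c d (4∣xy+1 0<b 0<c b≢c q∣ab+1 q∣ac+1 bc)
                    (4∣xy+1 0<b 0<d b≢d q∣ab+1 q∣ad+1 bd)
                    (4∣xy+1 0<c 0<d c≢d q∣ac+1 q∣ad+1 cd)
  where
  q∣ax+1 : ∀ {x} → 0 < x → IsSUnit₂ q (a * x + 1) → q ∣ a * x + 1
  q∣ax+1 {x} 0<x ax = oddSUnit⇒q∣ ax (+-monoˡ-≤ 1 (*-mono-≤ 0<a 0<x))
    (λ 2∣ax+1 → prime∤1 prime[2] (∣m+n∣m⇒∣n 2∣ax+1 (∣m⇒∣m*n x 2∣a)))
  q∣ab+1 = q∣ax+1 0<b ab
  q∣ac+1 = q∣ax+1 0<c ac
  q∣ad+1 = q∣ax+1 0<d ad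
  4∣xy+1 : ∀ {x y} → 0 < x → 0 < y → x ≢ y → q ∣ a * x + 1 → q ∣ a * y + 1 →
           IsSUnit₂ q (x * y + 1) → 4 ∣ x * y + 1
  4∣xy+1 {x} {y} 0<x 0<y x≢y q∣ax+1 q∣ay+1 xy = sUnit∧q∤⇒4∣ xy (+-monoˡ-≤ 1 (2≤m*n 0<x 0<y x≢y))
    (q∣ab+1∧q∣ac+1⇒q∤bc+1 {a = a} {x} {y} q-prime nonres q∣ax+1 q∣ay+1)

lemma4 : (q : ℕ) → Prime q → q % 4 ≡ 3 →
         (a b c d : ℕ) → IsSDiophantineQuadruple₂ q a b c d →
         ¬ (2 ∣ a) × ¬ (2 ∣ b) × ¬ (2 ∣ c) × ¬ (2 ∣ d)
lemma4 zero    _       ()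
lemma4 (suc n) q-prime q%4≡3 a b c d
  ((0<a , 0<b , 0<c , 0<d) , (a≢b , a≢c , a≢d , b≢c , b≢d , c≢d) , (ab , ac , ad , bc , bd , cd)) =
  no-even-entry q-prime nonres 0<a 0<b 0<c 0<d b≢c b≢d c≢d ab ac ad bc bd cd ,
  no-even-entry q-prime nonres 0<b 0<a 0<c 0<d a≢c a≢d c≢d (sUnit-comm a b ab) bc bd ac ad cd ,
  no-even-entry q-prime nonres 0<c 0<a 0<b 0<d a≢b a≢d b≢d (sUnit-comm a c ac) (sUnit-comm b c bc) cd ab ad bd ,
  no-even-entry q-prime nonres 0<d 0<a 0<b 0<c a≢b a≢c b≢c (sUnit-comm a d ad) (sUnit-comm b d bd) (sUnit-comm c d cd) ab ac bc
  where
  nonres : MinusOneNonResidue (suc n)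
  nonres = PrimeModulus.-1-nonresidue q-prime q%4≡3
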